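{- If $\mathcal C$ is an inductively pierced code, then its simplicial complex $\Delta(\mathcal C)$ is a clique complex (flag complex): whenever $\sigma\subseteq[n]$ is such that $\{i,j\}\in\Delta(\mathcal C)$ for all $i,j\in\sigma$, then $\sigma\in\Delta(\mathcal C)$.
   Context: A neural code on $n$ neurons is a set $\mathcal C\subseteq 2^{[n]}$. Its simplicial complex $\Delta(\mathcal C)$ is the smallest simplicial complex containing $\mathcal C$, i.e. all subsets of codewords. Piercing: let $\mathcal C$ be a code on $[n]$ and $(\lambda,\sigma,\tau)$ a partition of $[n]$ into three disjoint (possibly empty) sets with $|\lambda|=j$. $\mathcal C$ is $(\lambda,\sigma,\tau)$-pierceable if $\sigma\cup\nu\in\mathcal C$ for every $\nu\subseteq\lambda$; then the $j$-piercing is the code on $[n+1]$ given by $\mathcal C\cup\{\sigma\cup\nu\cup\{n+1\}:\nu\subseteq\lambda\}$. A code is inductively $k$-pierced if it is $\{\varnothing,\{1\}\}$ or is obtained from an inductively $k$-pierced code on $n-1$ neurons by a $j$-piercing with $j\le k$. A code is inductively pierced if it is inductively $k$-pierced for some $k\ge0$. -}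

module Defs where

open import Level using (0ℓ) renaming (suc to lsuc)
open import Data.Nat using (ℕ; suc; _≤_)
open import Data.Fin using (Fin)
open import Data.Fin.Subset using (Subset; _⊆_; _∈_; _∪_; _∩_; ⊥; ⊤; ⁅_⁆; ∣_∣; inside; outside)
open import Data.Vec using (_∷ʳ_)
open import Data.Product using (Σ; ∃; ∃-syntax; _×_)
open import Data.Sum using (_⊎_)
open import Relation.Binary.PropositionalEquality using (_≡_)
open import Function.Bundles using (_⇔_)

Code : ℕ → Set₁
Code n = Subset n → Set

Δ : ∀ {n} → Code n → Subset n → Set
Δ C τ = ∃[ c ] (C c × τ ⊆ c)

IsCliqueComplex : ∀ {n} → Code n → Set
IsCliqueComplex {n} C =
  (σ : Subset n) →
  ((i j : Fin n) → i ∈ σ → j ∈ σ → Δ C (⁅ i ⁆ ∪ ⁅ j ⁆)) →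
  Δ C σ

IsPartition3 : ∀ {n} → Subset n → Subset n → Subset n → Set
IsPartition3 l s t =
  (l ∩ s ≡ ⊥) × (l ∩ t ≡ ⊥) × (s ∩ t ≡ ⊥) × (l ∪ s ∪ t ≡ ⊤)

Pierceable : ∀ {n} → Code n → Subset n → Subset n → Set
Pierceable C l s = ∀ ν → ν ⊆ l → C (s ∪ ν)

-- The piercing: a code on [n+1], the new neuron n+1 being the last coordinate.
-- Old codewords c are embedded as c (not containing n+1).
Piercing : ∀ {n} → Code n → Subset n → Subset n → Code (suc n)
Piercing C l s x =
  (∃[ c ] (C c × x ≡ c ∷ʳ outside)) ⊎
  (∃[ ν ] (ν ⊆ l × x ≡ (s ∪ ν) ∷ʳ inside))

BaseCode : Code 1
BaseCode x = (x ≡ ⊥) ⊎ (x ≡ ⊤)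

data IndPierced (k : ℕ) : (n : ℕ) → Code n → Set₁ where
  base   : IndPierced k 1 BaseCode
  pierce : ∀ {n} {C : Code n} → IndPierced k n C →
           (l s t : Subset n) → IsPartition3 l s t → ∣ l ∣ ≤ k →
           Pierceable C l s →
           IndPierced k (suc n) (Piercing C l s)

-- A code is inductively pierced if, as a set of codewords, it equals an
-- inductively k-pierced code for some k.
IsInductivelyPierced : ∀ {n} → Code n → Set₁
IsInductivelyPierced {n} C =
  ∃[ k ] Σ (Code n) (λ D → IndPierced k n D × (∀ x → C x ⇔ D x))

-- Piercing only adds codewords containing the new neuron, and those are exactly
-- σ ∪ ν ∪ {n+1} for ν ⊆ λ.  Hence a clique avoiding n+1 restricts to a clique of
-- the old code, while a clique σ′ ∪ {n+1} has every vertex of σ′ inside some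
-- σ ∪ ν, i.e. inside σ ∪ (σ′ ∩ λ), which is itself a codeword after piercing.
module Submission where

open import Defs
open import Data.Nat using (ℕ; suc)
open import Data.Fin using (Fin; zero; suc; inject₁; fromℕ)
open import Data.Fin.Subset using (Subset; _⊆_; _∈_; _∪_; _∩_; ⊤; ⁅_⁆; inside; outside)
open import Data.Fin.Subset.Properties
  using (⊆⊤; drop-∷-⊆; x∈⁅x⁆; x∈⁅y⁆⇒x≡y; x∈p∪q⁻; x∈p∪q⁺; x∈p∩q⁺; p∩q⊆q)
open import Data.Vec using (Vec; []; _∷_; _∷ʳ_; _[_]=_; here; there; initLast)
open import Data.Product using (∃-syntax; _×_; _,_)
open import Data.Sum using (inj₁; inj₂)
open import Relation.Binary.PropositionalEquality using (_≡_; refl; sym; subst)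
open import Function.Bundles using (_⇔_; Equivalence)

module _ {a} {A : Set a} where

  inject₁-[]=-∷ʳ⁺ : ∀ {n} {xs : Vec A n} {i x y} → xs [ i ]= x → (xs ∷ʳ y) [ inject₁ i ]= x
  inject₁-[]=-∷ʳ⁺ here      = here
  inject₁-[]=-∷ʳ⁺ (there p) = there (inject₁-[]=-∷ʳ⁺ p)

  inject₁-[]=-∷ʳ⁻ : ∀ {n} (xs : Vec A n) {i x y} → (xs ∷ʳ y) [ inject₁ i ]= x → xs [ i ]= x
  inject₁-[]=-∷ʳ⁻ (_ ∷ _)  {zero}  here      = here
  inject₁-[]=-∷ʳ⁻ (_ ∷ xs) {suc i} (there p) = there (inject₁-[]=-∷ʳ⁻ xs p)

  fromℕ-[]=-∷ʳ : ∀ {n} (xs : Vec A n) {y} → (xs ∷ʳ y) [ fromℕ n ]= y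
  fromℕ-[]=-∷ʳ []       = here
  fromℕ-[]=-∷ʳ (_ ∷ xs) = there (fromℕ-[]=-∷ʳ xs)

  fromℕ-[]=-∷ʳ⁻ : ∀ {n} (xs : Vec A n) {x y} → (xs ∷ʳ y) [ fromℕ n ]= x → x ≡ y
  fromℕ-[]=-∷ʳ⁻ []       here      = refl
  fromℕ-[]=-∷ʳ⁻ (_ ∷ xs) (there p) = fromℕ-[]=-∷ʳ⁻ xs p

∷ʳ-mono-⊆ : ∀ {n} {p q : Subset n} {b} → p ⊆ q → p ∷ʳ b ⊆ q ∷ʳ b
∷ʳ-mono-⊆ {p = []}    {q = []}    _   x∈      = x∈
∷ʳ-mono-⊆ {p = _ ∷ _} {q = _ ∷ _} p⊆q here     with p⊆q here
... | here = here
∷ʳ-mono-⊆ {p = _ ∷ _} {q = _ ∷ _} p⊆q (there x∈) = there (∷ʳ-mono-⊆ (drop-∷-⊆ p⊆q) x∈)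

⁅x⁆∪⁅y⁆⊆p⁺ : ∀ {n} {x y : Fin n} {p} → x ∈ p → y ∈ p → ⁅ x ⁆ ∪ ⁅ y ⁆ ⊆ p
⁅x⁆∪⁅y⁆⊆p⁺ {x = x} {y} {p} x∈p y∈p z∈ with x∈p∪q⁻ ⁅ x ⁆ ⁅ y ⁆ z∈
... | inj₁ z∈⁅x⁆ = subst (_∈ p) (sym (x∈⁅y⁆⇒x≡y x z∈⁅x⁆)) x∈p
... | inj₂ z∈⁅y⁆ = subst (_∈ p) (sym (x∈⁅y⁆⇒x≡y y z∈⁅y⁆)) y∈p

⁅x⁆∪⁅y⁆⊆p⁻ : ∀ {n} {x y : Fin n} {p} → ⁅ x ⁆ ∪ ⁅ y ⁆ ⊆ p → x ∈ p × y ∈ p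
⁅x⁆∪⁅y⁆⊆p⁻ {x = x} {y} xy⊆p = xy⊆p (x∈p∪q⁺ (inj₁ (x∈⁅x⁆ x))) , xy⊆p (x∈p∪q⁺ (inj₂ (x∈⁅x⁆ y)))

IsCliqueComplex-resp-⇔ : ∀ {n} {C D : Code n} → (∀ x → C x ⇔ D x) →
                         IsCliqueComplex D → IsCliqueComplex C
IsCliqueComplex-resp-⇔ C⇔D clique σ edges =
  let c , Dc , σ⊆c = clique σ λ i j i∈σ j∈σ →
        let d , Cd , ij⊆d = edges i j i∈σ j∈σ in d , Equivalence.to (C⇔D d) Cd , ij⊆d
  in  c , Equivalence.from (C⇔D c) Dc , σ⊆c

BaseCode-isCliqueComplex : IsCliqueComplex BaseCode
BaseCode-isCliqueComplex _ _ = ⊤ , inj₂ refl , ⊆⊤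

module _ {n} {C : Code n} {l s : Subset n} where

  Piercing-restrict : Pierceable C l s → ∀ {x} → Piercing C l s x →
                      ∃[ c ] (C c × ∀ {i} → inject₁ i ∈ x → i ∈ c)
  Piercing-restrict _ (inj₁ (c , Cc , refl))     = c , Cc , inject₁-[]=-∷ʳ⁻ c
  Piercing-restrict P (inj₂ (ν , ν⊆l , refl)) = s ∪ ν , P ν ν⊆l , inject₁-[]=-∷ʳ⁻ (s ∪ ν)

  Piercing-new : ∀ {x} → Piercing C l s x → fromℕ n ∈ x →
                 ∃[ ν ] (ν ⊆ l × x ≡ (s ∪ ν) ∷ʳ inside)
  Piercing-new (inj₁ (c , _ , refl)) n∈x with fromℕ-[]=-∷ʳ⁻ c n∈x
  ... | ()
  Piercing-new (inj₂ ν-witness) _ = ν-witness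

  Piercing-clique-old : IsCliqueComplex C → Pierceable C l s → (σ : Subset n) →
    (∀ i j → i ∈ σ → j ∈ σ → Δ (Piercing C l s) (⁅ inject₁ i ⁆ ∪ ⁅ inject₁ j ⁆)) →
    Δ (Piercing C l s) (σ ∷ʳ outside)
  Piercing-clique-old clique P σ edges =
    let c , Cc , σ⊆c = clique σ old-edges in c ∷ʳ outside , inj₁ (c , Cc , refl) , ∷ʳ-mono-⊆ σ⊆c
    where
    old-edges : ∀ i j → i ∈ σ → j ∈ σ → Δ C (⁅ i ⁆ ∪ ⁅ j ⁆)
    old-edges i j i∈σ j∈σ =
      let x , C′x , ij⊆x = edges i j i∈σ j∈σ
          i∈x , j∈x      = ⁅x⁆∪⁅y⁆⊆p⁻ ij⊆x
          c , Cc , x⊆c   = Piercing-restrict P C′x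
      in  c , Cc , ⁅x⁆∪⁅y⁆⊆p⁺ (x⊆c i∈x) (x⊆c j∈x)

  Piercing-clique-new : (σ : Subset n) →
    (∀ i → i ∈ σ → Δ (Piercing C l s) (⁅ inject₁ i ⁆ ∪ ⁅ fromℕ n ⁆)) →
    Δ (Piercing C l s) (σ ∷ʳ inside)
  Piercing-clique-new σ edges =
    (s ∪ (σ ∩ l)) ∷ʳ inside , inj₂ (σ ∩ l , p∩q⊆q σ l , refl) , ∷ʳ-mono-⊆ σ⊆s∪σ∩l
    where
    σ⊆s∪σ∩l : σ ⊆ s ∪ (σ ∩ l)
    σ⊆s∪σ∩l {i} i∈σ with edges i i∈σ
    ... | x , C′x , ij⊆x with ⁅x⁆∪⁅y⁆⊆p⁻ ij⊆x
    ... | i∈x , n∈x with Piercing-new C′x n∈x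
    ... | ν , ν⊆l , refl with x∈p∪q⁻ s ν (inject₁-[]=-∷ʳ⁻ (s ∪ ν) i∈x)
    ... | inj₁ i∈s = x∈p∪q⁺ (inj₁ i∈s)
    ... | inj₂ i∈ν = x∈p∪q⁺ (inj₂ (x∈p∩q⁺ (i∈σ , ν⊆l i∈ν)))

  Piercing-isCliqueComplex : Pierceable C l s → IsCliqueComplex C →
                             IsCliqueComplex (Piercing C l s)
  Piercing-isCliqueComplex P clique σ′ edges with initLast σ′
  ... | σ , outside , refl = Piercing-clique-old clique P σ λ i j i∈σ j∈σ →
    edges (inject₁ i) (inject₁ j) (inject₁-[]=-∷ʳ⁺ i∈σ) (inject₁-[]=-∷ʳ⁺ j∈σ)
  ... | σ , inside  , refl = Piercing-clique-new σ λ i i∈σ →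
    edges (inject₁ i) (fromℕ n) (inject₁-[]=-∷ʳ⁺ i∈σ) (fromℕ-[]=-∷ʳ σ)

IndPierced⇒IsCliqueComplex : ∀ {k n} {C : Code n} → IndPierced k n C → IsCliqueComplex C
IndPierced⇒IsCliqueComplex base                    = BaseCode-isCliqueComplex
IndPierced⇒IsCliqueComplex (pierce C-pierced _ _ _ _ _ P) =
  Piercing-isCliqueComplex P (IndPierced⇒IsCliqueComplex C-pierced)

mainTheorem3 : (n : ℕ) (C : Code n) → IsInductivelyPierced C → IsCliqueComplex C
mainTheorem3 n C (k , D , D-pierced , C⇔D) =
  IsCliqueComplex-resp-⇔ C⇔D (IndPierced⇒IsCliqueComplex D-pierced)
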